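{- Fix an integer $b\geq 2$. For each positive integer $k$, the numbers $0,1,\dots,bk-1$ can be arranged (each used exactly once) in a $b\times k$ matrix $A_k=[a_{i,j}]_{1\le i\le b,\,1\le j\le k}$ such that: (i) $a_{1,j}=j-1$ for $j=1,\dots,k$; (ii) $a_{1,j}\prec_b a_{i,j}$ for $i=1,\dots,b$ and $j=1,\dots,k$; and (iii) $a_{i,j}-a_{1,j}$ is the sum of exactly $i-1$ powers of $b$; that is, $s_b(a_{i,j})=s_b(a_{1,j})+i-1$, for $i=1,\dots,b$ and $j=1,\dots,k$.
   Context: For $n\in\mathbb{Z}_{\ge0}$ write $n=\sum_{i\ge0}\alpha_i(n;b)b^i$ with digits $\alpha_i(n;b)\in\{0,\dots,b-1\}$, and let $s_b(n)=\sum_i\alpha_i(n;b)$. The partial order $\prec_b$ is defined by $n\prec_b m$ iff $\alpha_i(n;b)\leq\alpha_i(m;b)$ for every $i$. A "power of $b$" means $b^r$ with $r\in\mathbb{Z}_{\ge0}$ (repetitions allowed in the sum). -}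

module Defs where

open import Data.Nat using (ℕ; zero; suc; _+_; _*_; _^_; _≤_; _<_; NonZero; >-nonZero)
open import Data.Nat.Properties using (m^n>0)
open import Data.Nat.DivMod using (_/_; _%_)
open import Data.List using (List; map)
open import Data.Nat.ListAction using (sum)

digit : (b : ℕ) → .{{NonZero b}} → ℕ → ℕ → ℕ
digit b n i = ((_/_ n (b ^ i)) {{>-nonZero (m^n>0 b i)}}) % b

sumDigitsUpTo : (b : ℕ) → .{{NonZero b}} → ℕ → ℕ → ℕ
sumDigitsUpTo b n zero = 0
sumDigitsUpTo b n (suc r) = digit b n r + sumDigitsUpTo b n r

-- for b ≥ 2, n < b^n, so all digits at positions ≥ n are zero
s : (b : ℕ) → .{{NonZero b}} → ℕ → ℕ
s b n = sumDigitsUpTo b n (suc n)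

_≼[_]_ : ℕ → (b : ℕ) → .{{NonZero b}} → ℕ → Set
n ≼[ b ] m = ∀ (i : ℕ) → digit b n i ≤ digit b m i

sumPowers : ℕ → List ℕ → ℕ
sumPowers b rs = sum (map (b ^_) rs)

module Submission where

-- Construction, by recursion on the number m of digits.  Let B = b ^ m and
-- write a width k ≤ b B as k = c B + r with r < B.  Numbers below b k are
-- y₀ + (y₁ + x b) B  with y₀ < B and base-b digits y₁, x ≤ c.  A column
-- j₀ + j₁ B with j₁ < c receives in row i the number with low part j₀ and
-- the digits i, j₁ at positions m, m + 1, their order decided by comparing
-- i with c.  The last r columns j₀ + c B take the solution for width r,
-- each entry y₀ + d B lifted by writing c and d at positions m, m + 1,
-- the larger one first.  An explicit inverse (locate) gives injectivity,
-- and a case analysis on the digits of n < b k gives surjectivity.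

open import Defs
open import Data.Nat using (ℕ; zero; suc; _+_; _*_; _^_; _≤_; _<_; NonZero; _∸_; z≤n; s≤s; _<?_; >-nonZero⁻¹)
open import Data.Nat.Properties
open import Data.Nat.DivMod
open import Data.Nat.Divisibility using (divides-refl)
open import Data.Nat.ListAction using (sum)
open import Data.Nat.ListAction.Properties using (sum-++)
open import Data.Nat.Tactic.RingSolver using (solve-∀)
open import Data.Bool using (if_then_else_)
open import Data.Empty using (⊥-elim)
open import Data.Sum using ([_,_]′)
open import Data.Product using (Σ; ∃; ∃-syntax; _×_; _,_; proj₁; proj₂)
open import Data.List using (List; length; []; _∷_; map; _++_; replicate)
open import Data.List.Properties using (length-++; length-replicate; length-map; map-++)
open import Data.Fin using (Fin; toℕ; fromℕ<)
open import Data.Fin.Properties using (toℕ-injective; toℕ-fromℕ<; toℕ<n)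
open import Function using (_∘₂_)
open import Relation.Binary.PropositionalEquality
open import Relation.Binary.Definitions using (tri<; tri≈; tri>)
open import Relation.Nullary using (¬_; Dec; does; yes; no)
open import Relation.Nullary.Decidable using (dec-true; dec-false)

[v+w*n]%n≡v : ∀ v w {n} .{{_ : NonZero n}} → v < n → (v + w * n) % n ≡ v
[v+w*n]%n≡v v w {n} v<n = trans ([m+kn]%n≡m%n v w n) (m<n⇒m%n≡m v<n)

[v+w*n]/n≡w : ∀ v w {n} .{{_ : NonZero n}} → v < n → (v + w * n) / n ≡ w
[v+w*n]/n≡w v w {n} v<n =
  trans (+-distrib-/-∣ʳ v (divides-refl w)) (cong₂ _+_ (m<n⇒m/n≡0 v<n) (m*n/n≡m w n))

v+w*X<Y*X : ∀ {v X w Y} → v < X → w < Y → v + w * X < Y * X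
v+w*X<Y*X {v} {X} {w} {Y} v<X w<Y = begin-strict
  v + w * X   <⟨ +-monoˡ-< (w * X) v<X ⟩
  suc w * X   ≤⟨ *-monoˡ-≤ X w<Y ⟩
  Y * X       ∎
  where open ≤-Reasoning

-- Base-b digits, for an arbitrary base b ≥ 1.  Everything is reduced to the
-- splitting  n = n % b + (n / b) * b  into last digit and remaining digits.
module Digits (b : ℕ) .{{_ : NonZero b}} where

  digit-zero : ∀ n → digit b n 0 ≡ n % b
  digit-zero n = cong (_% b) (n/1≡n n)

  digit-suc : ∀ n t → digit b n (suc t) ≡ digit b (n / b) t
  digit-suc n t = cong (_% b) (sym (m/n/o≡m/[n*o] n b (b ^ t) {{_}} {{m^n≢0 b t}} {{m^n≢0 b (suc t)}}))

  digit-small : ∀ {n} t → n < b ^ t → digit b n t ≡ 0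
  digit-small {n} t n<b^t =
    trans (cong (_% b) (m<n⇒m/n≡0 {{m^n≢0 b t}} n<b^t)) (m<n⇒m%n≡m (>-nonZero⁻¹ b))

  split-last : ∀ y w m → y + w * b ^ suc m ≡ y % b + (y / b + w * b ^ m) * b
  split-last y w m = begin
    y + w * b ^ suc m                          ≡⟨ cong (_+ w * b ^ suc m) (m≡m%n+[m/n]*n y b) ⟩
    (y % b + (y / b) * b) + w * (b * b ^ m)    ≡⟨ regroup (y % b) (y / b) w b (b ^ m) ⟩
    y % b + (y / b + w * b ^ m) * b            ∎
    where
    open ≡-Reasoning
    regroup : ∀ a q w b B → (a + q * b) + w * (b * B) ≡ a + (q + w * B) * b
    regroup = solve-∀

  /b<b^m : ∀ {y} m → y < b ^ suc m → y / b < b ^ m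
  /b<b^m {y} m y< = m<n*o⇒m/o<n (subst (y <_) (*-comm b (b ^ m)) y<)

  ≼-last : ∀ {j n} → j ≼[ b ] n → j % b ≤ n % b
  ≼-last {j} {n} j≼n = subst₂ _≤_ (digit-zero j) (digit-zero n) (j≼n 0)

  ≼-init : ∀ {j n} → j ≼[ b ] n → (j / b) ≼[ b ] (n / b)
  ≼-init {j} {n} j≼n t = subst₂ _≤_ (digit-suc j t) (digit-suc n t) (j≼n (suc t))

  ≼-join : ∀ {j n} → j % b ≤ n % b → (j / b) ≼[ b ] (n / b) → j ≼[ b ] n
  ≼-join {j} {n} last init zero    = subst₂ _≤_ (sym (digit-zero j)) (sym (digit-zero n)) last
  ≼-join {j} {n} last init (suc t) = subst₂ _≤_ (sym (digit-suc j t)) (sym (digit-suc n t)) (init t)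

  ≼-refl : ∀ n → n ≼[ b ] n
  ≼-refl n t = ≤-refl

  0≼ : ∀ n → 0 ≼[ b ] n
  0≼ n t = subst (_≤ digit b n t) (sym (digit-small t (m^n>0 b t))) z≤n

  ≼-cons : ∀ {v v′ w w′} → v < b → v′ < b → v ≤ v′ → w ≼[ b ] w′ →
           (v + w * b) ≼[ b ] (v′ + w′ * b)
  ≼-cons {v} {v′} {w} {w′} v<b v′<b v≤v′ w≼w′ =
    ≼-join (subst₂ _≤_ (sym ([v+w*n]%n≡v v w v<b)) (sym ([v+w*n]%n≡v v′ w′ v′<b)) v≤v′)
           (subst₂ (λ p q → p ≼[ b ] q) (sym ([v+w*n]/n≡w v w v<b)) (sym ([v+w*n]/n≡w v′ w′ v′<b)) w≼w′)

  ≼-concat : ∀ m {y y′ w w′} → y < b ^ m → y′ < b ^ m → y ≼[ b ] y′ → w ≼[ b ] w′ →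
             (y + w * b ^ m) ≼[ b ] (y′ + w′ * b ^ m)
  ≼-concat zero {w = w} {w′} (s≤s z≤n) (s≤s z≤n) _ w≼w′ =
    subst₂ (λ p q → p ≼[ b ] q) (sym (*-identityʳ w)) (sym (*-identityʳ w′)) w≼w′
  ≼-concat (suc m) {y} {y′} {w} {w′} y< y′< y≼y′ w≼w′ =
    subst₂ (λ p q → p ≼[ b ] q) (sym (split-last y w m)) (sym (split-last y′ w′ m))
      (≼-cons (m%n<n y b) (m%n<n y′ b) (≼-last y≼y′)
        (≼-concat m (/b<b^m m y<) (/b<b^m m y′<) (≼-init y≼y′) w≼w′))

  ≼-truncate : ∀ m {j y w} → j < b ^ m → y < b ^ m → j ≼[ b ] (y + w * b ^ m) → j ≼[ b ] y
  ≼-truncate zero (s≤s z≤n) (s≤s z≤n) _ = ≼-refl 0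
  ≼-truncate (suc m) {j} {y} {w} j< y< j≼ =
    ≼-join last (≼-truncate m {w = w} (/b<b^m m j<) (/b<b^m m y<) init)
    where
    high : ℕ
    high = y / b + w * b ^ m
    split : y + w * b ^ suc m ≡ y % b + high * b
    split = split-last y w m
    last : j % b ≤ y % b
    last = subst (j % b ≤_) (trans (cong (_% b) split) ([v+w*n]%n≡v (y % b) high (m%n<n y b))) (≼-last j≼)
    init : (j / b) ≼[ b ] high
    init = subst (λ q → (j / b) ≼[ b ] q) (trans (cong (_/ b) split) ([v+w*n]/n≡w (y % b) high (m%n<n y b))) (≼-init j≼)

-- The digit sum  s b,  for a base b ≥ 2 (so that n < b ^ n and  s b n  sees all
-- digits of n).  It is additive under appending digits.
module DigitSum (b : ℕ) .{{_ : NonZero b}} (2≤b : 2 ≤ b) where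
  open Digits b

  n<b^n : ∀ n → n < b ^ n
  n<b^n zero    = s≤s z≤n
  n<b^n (suc n) = begin-strict
    suc n          ≤⟨ n<b^n n ⟩
    b ^ n          <⟨ m<m+n (b ^ n) (m^n>0 b n) ⟩
    b ^ n + b ^ n  ≡⟨ cong (b ^ n +_) (sym (+-identityʳ (b ^ n))) ⟩
    2 * b ^ n      ≤⟨ *-monoˡ-≤ (b ^ n) 2≤b ⟩
    b * b ^ n      ∎
    where open ≤-Reasoning

  private
    Σdigits : ℕ → ℕ → ℕ
    Σdigits n R = sumDigitsUpTo b n R

  Σdigits-stable : ∀ n R e → n < b ^ R → Σdigits n (R + e) ≡ Σdigits n R
  Σdigits-stable n R zero    n< = cong (Σdigits n) (+-identityʳ R)
  Σdigits-stable n R (suc e) n< = begin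
    Σdigits n (R + suc e)                   ≡⟨ cong (Σdigits n) (+-suc R e) ⟩
    digit b n (R + e) + Σdigits n (R + e)   ≡⟨ cong₂ _+_ vanish (Σdigits-stable n R e n<) ⟩
    Σdigits n R                             ∎
    where
    open ≡-Reasoning
    vanish : digit b n (R + e) ≡ 0
    vanish = digit-small (R + e) (<-≤-trans n< (^-monoʳ-≤ b (m≤m+n R e)))

  s≡Σdigits : ∀ n R → n < b ^ R → s b n ≡ Σdigits n R
  s≡Σdigits n R n< = begin
    Σdigits n (suc n)      ≡⟨ sym (Σdigits-stable n (suc n) R (<-≤-trans (n<b^n n) (^-monoʳ-≤ b (n≤1+n n)))) ⟩
    Σdigits n (suc n + R)  ≡⟨ cong (Σdigits n) (+-comm (suc n) R) ⟩
    Σdigits n (R + suc n)  ≡⟨ Σdigits-stable n R (suc n) n< ⟩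
    Σdigits n R            ∎
    where open ≡-Reasoning

  Σdigits-suc : ∀ n R → Σdigits n (suc R) ≡ n % b + Σdigits (n / b) R
  Σdigits-suc n zero    = cong (_+ 0) (digit-zero n)
  Σdigits-suc n (suc R) = begin
    digit b n (suc R) + Σdigits n (suc R)              ≡⟨ cong₂ _+_ (digit-suc n R) (Σdigits-suc n R) ⟩
    digit b (n / b) R + (n % b + Σdigits (n / b) R)    ≡⟨ x+[y+z]≡y+[x+z] (digit b (n / b) R) (n % b) _ ⟩
    n % b + Σdigits (n / b) (suc R)                    ∎
    where
    open ≡-Reasoning
    x+[y+z]≡y+[x+z] : ∀ x y z → x + (y + z) ≡ y + (x + z)
    x+[y+z]≡y+[x+z] = solve-∀

  s-step : ∀ n → s b n ≡ n % b + s b (n / b)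
  s-step n = trans (Σdigits-suc n n) (cong (n % b +_) (sym (s≡Σdigits (n / b) n (/b<b^m n n<))))
    where
    n< : n < b ^ suc n
    n< = <-≤-trans (n<b^n n) (^-monoʳ-≤ b (n≤1+n n))

  s-zero : s b 0 ≡ 0
  s-zero = cong (_+ 0) (digit-small 0 (s≤s z≤n))

  s-cons : ∀ {v} w → v < b → s b (v + w * b) ≡ v + s b w
  s-cons {v} w v<b =
    trans (s-step _) (cong₂ (λ p q → p + s b q) ([v+w*n]%n≡v v w v<b) ([v+w*n]/n≡w v w v<b))

  s-digit : ∀ {v} → v < b → s b v ≡ v
  s-digit {v} v<b = begin
    s b v            ≡⟨ cong (s b) (sym (+-identityʳ v)) ⟩
    s b (v + 0 * b)  ≡⟨ s-cons 0 v<b ⟩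
    v + s b 0        ≡⟨ cong (v +_) s-zero ⟩
    v + 0            ≡⟨ +-identityʳ v ⟩
    v                ∎
    where open ≡-Reasoning

  s-concat : ∀ m {y} w → y < b ^ m → s b (y + w * b ^ m) ≡ s b y + s b w
  s-concat zero    w (s≤s z≤n) = trans (cong (s b) (*-identityʳ w)) (cong (_+ s b w) (sym s-zero))
  s-concat (suc m) {y}    w y< = begin
    s b (y + w * b ^ suc m)                  ≡⟨ cong (s b) (split-last y w m) ⟩
    s b (y % b + (y / b + w * b ^ m) * b)    ≡⟨ s-cons (y / b + w * b ^ m) (m%n<n y b) ⟩
    y % b + s b (y / b + w * b ^ m)          ≡⟨ cong (y % b +_) (s-concat m w (/b<b^m m y<)) ⟩
    y % b + (s b (y / b) + s b w)            ≡⟨ sym (+-assoc (y % b) _ _) ⟩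
    (y % b + s b (y / b)) + s b w            ≡⟨ cong (_+ s b w) (sym (s-step y)) ⟩
    s b y + s b w                            ∎
    where open ≡-Reasoning

  sumPowers-++ : ∀ xs ys → sumPowers b (xs ++ ys) ≡ sumPowers b xs + sumPowers b ys
  sumPowers-++ xs ys = trans (cong sum (map-++ (b ^_) xs ys)) (sum-++ (map (b ^_) xs) _)

  sumPowers-shift : ∀ rs → sumPowers b (map suc rs) ≡ b * sumPowers b rs
  sumPowers-shift []       = sym (*-zeroʳ b)
  sumPowers-shift (r ∷ rs) =
    trans (cong (b * b ^ r +_) (sumPowers-shift rs)) (sym (*-distribˡ-+ b (b ^ r) (sumPowers b rs)))

  sumPowers-ones : ∀ e → sumPowers b (replicate e 0) ≡ e
  sumPowers-ones zero    = refl
  sumPowers-ones (suc e) = cong suc (sumPowers-ones e)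

  -- If j ≼ n then n is j plus a sum of powers of b, and the number of powers
  -- is s(n) − s(j): the surplus of each digit is paid with copies of its power.
  -- (Induction on a bound b ^ R for j and n.)
  ≼⇒sumPowers-below : ∀ R {j n} → j < b ^ R → n < b ^ R → j ≼[ b ] n →
    Σ (List ℕ) λ rs → (n ≡ j + sumPowers b rs) × (s b n ≡ s b j + length rs)
  ≼⇒sumPowers-below zero (s≤s z≤n) (s≤s z≤n) _ = [] , refl , sym (+-identityʳ (s b 0))
  ≼⇒sumPowers-below (suc R) {j} {n} j< n< j≼n
    with rs , n/b≡ , s[n/b]≡ ← ≼⇒sumPowers-below R (/b<b^m R j<) (/b<b^m R n<) (≼-init j≼n) =
    rs⁺ , value , digitSum
    where
    e : ℕ
    e = n % b ∸ j % b
    n%b≡ : n % b ≡ j % b + e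
    n%b≡ = sym (m+[n∸m]≡n (≼-last j≼n))
    rs⁺ : List ℕ
    rs⁺ = replicate e 0 ++ map suc rs
    sumPowers-rs⁺ : sumPowers b rs⁺ ≡ e + b * sumPowers b rs
    sumPowers-rs⁺ = trans (sumPowers-++ (replicate e 0) (map suc rs))
                          (cong₂ _+_ (sumPowers-ones e) (sumPowers-shift rs))
    length-rs⁺ : length rs⁺ ≡ e + length rs
    length-rs⁺ = trans (length-++ (replicate e 0)) (cong₂ _+_ (length-replicate e) (length-map suc rs))
    regroup₁ : ∀ a e c S b → (a + e) + (c + S) * b ≡ (a + c * b) + (e + b * S)
    regroup₁ = solve-∀
    regroup₂ : ∀ a e c L → (a + e) + (c + L) ≡ (a + c) + (e + L)
    regroup₂ = solve-∀
    open ≡-Reasoning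
    value : n ≡ j + sumPowers b rs⁺
    value = begin
      n                                              ≡⟨ m≡m%n+[m/n]*n n b ⟩
      n % b + (n / b) * b                            ≡⟨ cong₂ (λ p q → p + q * b) n%b≡ n/b≡ ⟩
      (j % b + e) + (j / b + sumPowers b rs) * b     ≡⟨ regroup₁ (j % b) e (j / b) (sumPowers b rs) b ⟩
      (j % b + (j / b) * b) + (e + b * sumPowers b rs) ≡⟨ cong₂ _+_ (sym (m≡m%n+[m/n]*n j b)) (sym sumPowers-rs⁺) ⟩
      j + sumPowers b rs⁺                            ∎
    digitSum : s b n ≡ s b j + length rs⁺
    digitSum = begin
      s b n                                          ≡⟨ s-step n ⟩
      n % b + s b (n / b)                            ≡⟨ cong₂ _+_ n%b≡ s[n/b]≡ ⟩
      (j % b + e) + (s b (j / b) + length rs)        ≡⟨ regroup₂ (j % b) e (s b (j / b)) (length rs) ⟩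
      (j % b + s b (j / b)) + (e + length rs)        ≡⟨ cong₂ _+_ (sym (s-step j)) (sym length-rs⁺) ⟩
      s b j + length rs⁺                             ∎

  ≼⇒sumPowers : ∀ {j n} → j ≼[ b ] n →
    Σ (List ℕ) λ rs → (n ≡ j + sumPowers b rs) × (s b n ≡ s b j + length rs)
  ≼⇒sumPowers {j} {n} = ≼⇒sumPowers-below (j + n)
    (<-≤-trans (n<b^n j) (^-monoʳ-≤ b (m≤m+n j n)))
    (<-≤-trans (n<b^n n) (^-monoʳ-≤ b (m≤n+m n j)))

  exactly-powers : ∀ {j n i} → j ≼[ b ] n → s b n ≡ s b j + i →
    ∃[ rs ] (length rs ≡ i × n ≡ j + sumPowers b rs)
  exactly-powers {j} {n} {i} j≼n s-n with rs , n≡ , s-n′ ← ≼⇒sumPowers j≼n =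
    rs , +-cancelˡ-≡ (s b j) (length rs) i (trans (sym s-n′) s-n) , n≡

module Construction (b : ℕ) .{{_ : NonZero b}} (2≤b : 2 ≤ b) where
  open Digits b
  open DigitSum b 2≤b

  module Step (m : ℕ) where
    B : ℕ
    B = b ^ m

    instance
      B≢0 : NonZero B
      B≢0 = m^n≢0 b m

    assemble : ℕ → ℕ → ℕ → ℕ
    assemble x y₁ y₀ = y₀ + (y₁ + x * b) * B

    -- An entry z < b B of a smaller matrix, moved into a column with
    -- digit c at position m: the digits c and d = z / B are written at
    -- positions m, m + 1 with the larger one at position m.
    lift : ℕ → ℕ → ℕ
    lift c z = if does (z / B <? c)
               then assemble (z / B) c (z % B)
               else assemble c (z / B) (z % B)

    -- The entry of row i in a column j < c B (whose digit at position m is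
    -- j / B < c), where the matrix has k = c B + r columns.
    mainEntry : ℕ → ℕ → ℕ → ℕ → ℕ
    mainEntry c r j i =
      if does (i <? c)         then assemble i (j / B) (j % B) else
      if does (c <? i)         then assemble (j / B) i (j % B) else
      if does (j <? b * r)     then assemble c (j / B) (j % B)
                               else assemble (j / B) c (j % B)

    stepF : (ℕ → ℕ → ℕ → ℕ) → ℕ → ℕ → ℕ → ℕ
    stepF F k j i = if does (j <? k / B * B)
                    then mainEntry (k / B) (k % B) j i
                    else lift (k / B) (F (k % B) (j ∸ k / B * B) i)

    liftPos : ℕ → ℕ × ℕ → ℕ × ℕ
    liftPos c p = (proj₁ p + c * B , proj₂ p)

    -- Position (column, row) of the entry  assemble x y₁ y₀  (inverse of stepF).
    locate : (ℕ → ℕ → ℕ × ℕ) → (c r x y₁ y₀ : ℕ) → ℕ × ℕ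
    locate G c r x y₁ y₀ =
      if does (x <? c) then
        (if does (y₁ <? c)             then (y₀ + y₁ * B , x) else
         if does (c <? y₁)             then (y₀ + x * B , y₁) else
         if does (y₀ + x * B <? b * r) then liftPos c (G r (y₀ + x * B))
                                       else (y₀ + x * B , c))
      else
        (if does (y₁ <? c) then (y₀ + y₁ * B , c) else liftPos c (G r (y₀ + y₁ * B)))

    stepG : (ℕ → ℕ → ℕ × ℕ) → ℕ → ℕ → ℕ × ℕ
    stepG G k n = locate G (k / B) (k % B) (n / B / b) (n / B % b) (n % B)

    lift-below : ∀ {c z} → z / B < c → lift c z ≡ assemble (z / B) c (z % B)
    lift-below {c} {z} d<c rewrite dec-true (z / B <? c) d<c = refl

    lift-above : ∀ {c z} → ¬ (z / B < c) → lift c z ≡ assemble c (z / B) (z % B)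
    lift-above {c} {z} d≮c rewrite dec-false (z / B <? c) d≮c = refl

    module Unfold (F : ℕ → ℕ → ℕ → ℕ) (G : ℕ → ℕ → ℕ × ℕ) (k : ℕ) where
      private
        c r : ℕ
        c = k / B
        r = k % B

      mainEntry-< : ∀ {j i} → i < c → mainEntry c r j i ≡ assemble i (j / B) (j % B)
      mainEntry-< {j} {i} i<c rewrite dec-true (i <? c) i<c = refl

      mainEntry-> : ∀ {j i} → c < i → mainEntry c r j i ≡ assemble (j / B) i (j % B)
      mainEntry-> {j} {i} c<i rewrite dec-false (i <? c) (<⇒≯ c<i) | dec-true (c <? i) c<i = refl

      mainEntry-low : ∀ {j} → j < b * r → mainEntry c r j c ≡ assemble c (j / B) (j % B)
      mainEntry-low {j} j<br rewrite dec-false (c <? c) (n≮n c) | dec-true (j <? b * r) j<br = refl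

      mainEntry-high : ∀ {j} → ¬ (j < b * r) → mainEntry c r j c ≡ assemble (j / B) c (j % B)
      mainEntry-high {j} j≮br rewrite dec-false (c <? c) (n≮n c) | dec-false (j <? b * r) j≮br = refl

      stepF-main : ∀ {j i} → j < c * B → stepF F k j i ≡ mainEntry c r j i
      stepF-main {j} {i} j<cB rewrite dec-true (j <? c * B) j<cB = refl

      stepF-top : ∀ j₀ i → stepF F k (j₀ + c * B) i ≡ lift c (F r j₀ i)
      stepF-top j₀ i rewrite dec-false (j₀ + c * B <? c * B) (m+n≮n j₀ (c * B))
                           | m+n∸n≡m j₀ (c * B) = refl

      module _ {y₀ : ℕ} where
        locate-1 : ∀ {x y₁} → x < c → y₁ < c → locate G c r x y₁ y₀ ≡ (y₀ + y₁ * B , x)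
        locate-1 {x} {y₁} x<c y₁<c rewrite dec-true (x <? c) x<c | dec-true (y₁ <? c) y₁<c = refl

        locate-2 : ∀ {x y₁} → x < c → c < y₁ → locate G c r x y₁ y₀ ≡ (y₀ + x * B , y₁)
        locate-2 {x} {y₁} x<c c<y₁
          rewrite dec-true (x <? c) x<c | dec-false (y₁ <? c) (<⇒≯ c<y₁) | dec-true (c <? y₁) c<y₁ = refl

        locate-3 : ∀ {x} → x < c → y₀ + x * B < b * r →
                   locate G c r x c y₀ ≡ liftPos c (G r (y₀ + x * B))
        locate-3 {x} x<c z<br
          rewrite dec-true (x <? c) x<c | dec-false (c <? c) (n≮n c) | dec-true (y₀ + x * B <? b * r) z<br = refl

        locate-4 : ∀ {x} → x < c → ¬ (y₀ + x * B < b * r) → locate G c r x c y₀ ≡ (y₀ + x * B , c)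
        locate-4 {x} x<c z≮br
          rewrite dec-true (x <? c) x<c | dec-false (c <? c) (n≮n c) | dec-false (y₀ + x * B <? b * r) z≮br = refl

        locate-5 : ∀ {y₁} → y₁ < c → locate G c r c y₁ y₀ ≡ (y₀ + y₁ * B , c)
        locate-5 {y₁} y₁<c rewrite dec-false (c <? c) (n≮n c) | dec-true (y₁ <? c) y₁<c = refl

        locate-6 : ∀ {y₁} → ¬ (y₁ < c) → locate G c r c y₁ y₀ ≡ liftPos c (G r (y₀ + y₁ * B))
        locate-6 {y₁} y₁≮c rewrite dec-false (c <? c) (n≮n c) | dec-false (y₁ <? c) y₁≮c = refl

    assemble-%B : ∀ x y₁ {y₀} → y₀ < B → assemble x y₁ y₀ % B ≡ y₀
    assemble-%B x y₁ {y₀} y₀<B = [v+w*n]%n≡v y₀ (y₁ + x * b) y₀<B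

    assemble-/B : ∀ x y₁ {y₀} → y₀ < B → assemble x y₁ y₀ / B ≡ y₁ + x * b
    assemble-/B x y₁ {y₀} y₀<B = [v+w*n]/n≡w y₀ (y₁ + x * b) y₀<B

    assemble-parts : ∀ n → n ≡ assemble (n / B / b) (n / B % b) (n % B)
    assemble-parts n =
      trans (m≡m%n+[m/n]*n n B) (cong (λ q → n % B + q * B) (m≡m%n+[m/n]*n (n / B) b))

    stepG-assemble : ∀ {G k x y₁ y₀} → y₁ < b → y₀ < B →
                     stepG G k (assemble x y₁ y₀) ≡ locate G (k / B) (k % B) x y₁ y₀
    stepG-assemble {G} {k} {x} {y₁} {y₀} y₁<b y₀<B
      rewrite assemble-%B x y₁ y₀<B | assemble-/B x y₁ y₀<B
            | [v+w*n]%n≡v y₁ x y₁<b | [v+w*n]/n≡w y₁ x y₁<b = refl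

    assemble-≼ : ∀ {j₀ j₁ x y₁ y₀} → j₀ < B → y₀ < B → j₁ < b → y₁ < b →
                 j₀ ≼[ b ] y₀ → j₁ ≤ y₁ → (j₀ + j₁ * B) ≼[ b ] assemble x y₁ y₀
    assemble-≼ {j₀} {j₁} {x} {y₁} j₀<B y₀<B j₁<b y₁<b j₀≼y₀ j₁≤y₁ =
      ≼-concat m j₀<B y₀<B j₀≼y₀
        (subst (λ q → q ≼[ b ] (y₁ + x * b)) (+-identityʳ j₁) (≼-cons j₁<b y₁<b j₁≤y₁ (0≼ x)))

    assemble-s : ∀ {x y₁ y₀} → y₀ < B → y₁ < b → x < b →
                 s b (assemble x y₁ y₀) ≡ s b y₀ + (y₁ + x)
    assemble-s {x} {y₁} {y₀} y₀<B y₁<b x<b =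
      trans (s-concat m (y₁ + x * b) y₀<B) (cong (s b y₀ +_) (trans (s-cons x y₁<b) (cong (y₁ +_) (s-digit x<b))))

    column-s : ∀ {j₀ j₁} → j₀ < B → j₁ < b → s b (j₀ + j₁ * B) ≡ s b j₀ + j₁
    column-s {j₀} {j₁} j₀<B j₁<b = trans (s-concat m j₁ j₀<B) (cong (s b j₀ +_) (s-digit j₁<b))

    assemble-< : ∀ {c x y₁ y₀} → y₀ < B → y₁ < b → x < c → assemble x y₁ y₀ < c * b * B
    assemble-< y₀<B y₁<b x<c = v+w*X<Y*X y₀<B (v+w*X<Y*X y₁<b x<c)

    lift-small : ∀ {c z} → z < B → lift c z ≡ z + c * B
    lift-small {zero}  {z} z<B =
      trans (lift-above {0} (λ ())) (cong₂ (λ p q → q + (p + 0) * B) (m<n⇒m/n≡0 z<B) (m<n⇒m%n≡m z<B))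
    lift-small {suc c} {z} z<B = begin
      lift (suc c) z                          ≡⟨ lift-below (subst (_< suc c) (sym d≡0) (s≤s z≤n)) ⟩
      assemble (z / B) (suc c) (z % B)        ≡⟨ cong₂ (λ p q → q + (suc c + p * b) * B) d≡0 (m<n⇒m%n≡m z<B) ⟩
      z + (suc c + 0) * B                     ≡⟨ cong (λ q → z + q * B) (+-identityʳ (suc c)) ⟩
      z + suc c * B                           ∎
      where
      open ≡-Reasoning
      d≡0 : z / B ≡ 0
      d≡0 = m<n⇒m/n≡0 z<B

  record ValidEntry (G : ℕ → ℕ × ℕ) (k j i n : ℕ) : Set where
    field
      bounded  : n < b * k
      located  : G n ≡ (j , i)
      above    : j ≼[ b ] n
      digitSum : s b n ≡ s b j + i

  record Solution (F : ℕ → ℕ → ℕ) (G : ℕ → ℕ × ℕ) (k : ℕ) : Set where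
    field
      valid    : ∀ {j i} → j < k → i < b → ValidEntry G k j i (F j i)
      firstRow : ∀ {j} → j < k → F j 0 ≡ j
      onto     : ∀ {n} → n < b * k → ∃[ j ] ∃[ i ] (j < k × i < b × F j i ≡ n)

  module StepCorrect (m : ℕ) (F : ℕ → ℕ → ℕ → ℕ) (G : ℕ → ℕ → ℕ × ℕ)
                     (smaller : ∀ r → r < b ^ m → Solution (F r) (G r) r)
                     (k : ℕ) (k≤bB : k ≤ b * b ^ m) where
    open Step m
    open Unfold F G k

    c r : ℕ
    c = k / B
    r = k % B

    r<B : r < B
    r<B = m%n<n k B

    k≡r+cB : k ≡ r + c * B
    k≡r+cB = m≡m%n+[m/n]*n k B

    open Solution (smaller r r<B) renaming (valid to validᵣ; firstRow to firstRowᵣ; onto to ontoᵣ)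

    c≤b : c ≤ b
    c≤b = subst (c ≤_) (m*n/n≡m b B) (/-monoˡ-≤ B k≤bB)

    cB≤k : c * B ≤ k
    cB≤k = subst (c * B ≤_) (sym k≡r+cB) (m≤n+m (c * B) r)

    top<k : ∀ {j₀} → j₀ < r → j₀ + c * B < k
    top<k {j₀} j₀<r = subst (j₀ + c * B <_) (sym k≡r+cB) (+-monoˡ-< (c * B) j₀<r)

    c<b : ∀ {z} → z < b * r → c < b
    c<b {z} z<br = *-cancelʳ-< B c b (begin-strict
      c * B       <⟨ m<n+m (c * B) (n≢0⇒n>0 r≢0) ⟩
      r + c * B   ≡⟨ sym k≡r+cB ⟩
      k           ≤⟨ k≤bB ⟩
      b * B       ∎)
      where
      open ≤-Reasoning
      r≢0 : r ≢ 0
      r≢0 r≡0 = n≮0 (subst (z <_) (trans (cong (b *_) r≡0) (*-zeroʳ b)) z<br)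

    -- The numbers below b k: the c b B ones with top digit below c, then b r more.
    bk≡ : b * k ≡ b * r + c * b * B
    bk≡ = trans (cong (b *_) k≡r+cB) (distrib b r c B)
      where
      distrib : ∀ b r c B → b * (r + c * B) ≡ b * r + c * b * B
      distrib = solve-∀

    assemble-c : ∀ y₁ y₀ → assemble c y₁ y₀ ≡ (y₀ + y₁ * B) + c * b * B
    assemble-c y₁ y₀ = regroup y₀ y₁ c b B
      where
      regroup : ∀ y₀ y₁ c b B → y₀ + (y₁ + c * b) * B ≡ (y₀ + y₁ * B) + c * b * B
      regroup = solve-∀

    below-bk : ∀ {x y₁ y₀} → y₀ < B → y₁ < b → x < c → assemble x y₁ y₀ < b * k
    below-bk y₀<B y₁<b x<c =
      <-≤-trans (assemble-< y₀<B y₁<b x<c) (subst (c * b * B ≤_) (sym bk≡) (m≤n+m _ (b * r)))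

    top-below-bk : ∀ {y₁ y₀} → y₀ + y₁ * B < b * r → assemble c y₁ y₀ < b * k
    top-below-bk {y₁} {y₀} low<br =
      subst₂ _<_ (sym (assemble-c y₁ y₀)) (sym bk≡) (+-monoˡ-< (c * b * B) low<br)

    top-digit≤c : ∀ {n} → n < b * k → n / B / b ≤ c
    top-digit≤c {n} n<bk = ≤-pred (m<n*o⇒m/o<n (m<n*o⇒m/o<n (begin-strict
      n                           <⟨ n<bk ⟩
      b * k                       ≡⟨ bk≡ ⟩
      b * r + c * b * B           <⟨ +-monoˡ-< (c * b * B) (*-monoʳ-< b r<B) ⟩
      b * B + c * b * B           ≡⟨ sym (*-distribʳ-+ B b (c * b)) ⟩
      suc c * b * B               ∎)))
      where open ≤-Reasoning

    low<br : ∀ {y₁ y₀} → assemble c y₁ y₀ < b * k → y₀ + y₁ * B < b * r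
    low<br {y₁} {y₀} n<bk =
      +-cancelʳ-< (c * b * B) (y₀ + y₁ * B) (b * r) (subst₂ _<_ (assemble-c y₁ y₀) bk≡ n<bk)

    valid-assembled : ∀ {j₀ j₁ i x y₁ y₀} → j₀ < B → y₀ < B → j₁ < b → y₁ < b → x < b →
      j₀ ≼[ b ] y₀ → j₁ ≤ y₁ → s b y₀ + (y₁ + x) ≡ (s b j₀ + j₁) + i →
      assemble x y₁ y₀ < b * k → locate G c r x y₁ y₀ ≡ (j₀ + j₁ * B , i) →
      ValidEntry (stepG G k) k (j₀ + j₁ * B) i (assemble x y₁ y₀)
    valid-assembled {i = i} {x} j₀<B y₀<B j₁<b y₁<b x<b j₀≼y₀ j₁≤y₁ sums bound loc = record
      { bounded  = bound
      ; located  = trans (stepG-assemble {G} {k} y₁<b y₀<B) loc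
      ; above    = assemble-≼ {x = x} j₀<B y₀<B j₁<b y₁<b j₀≼y₀ j₁≤y₁
      ; digitSum = trans (assemble-s y₀<B y₁<b x<b) (trans sums (cong (_+ i) (sym (column-s j₀<B j₁<b))))
      }

    -- Columns j < c B, with low part j₀ and digit j₁ < c at position m.  The
    -- entry in row i is assemble x y₁ j₀ where {x , y₁} = {i , j₁} and j₁ ≤ y₁.
    module MainColumn {j} (j<cB : j < c * B) where
      j₀ j₁ : ℕ
      j₀ = j % B
      j₁ = j / B

      j₀<B : j₀ < B
      j₀<B = m%n<n j B

      j₁<c : j₁ < c
      j₁<c = m<n*o⇒m/o<n j<cB

      j₁<b : j₁ < b
      j₁<b = <-≤-trans j₁<c c≤b

      j≡ : j ≡ j₀ + j₁ * B
      j≡ = m≡m%n+[m/n]*n j B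

      valid-main : ∀ {i x y₁} → x < b → y₁ < b → j₁ ≤ y₁ → y₁ + x ≡ j₁ + i →
        stepF F k j i ≡ assemble x y₁ j₀ → assemble x y₁ j₀ < b * k →
        locate G c r x y₁ j₀ ≡ (j , i) → ValidEntry (stepG G k) k j i (stepF F k j i)
      valid-main {i} {x} {y₁} x<b y₁<b j₁≤y₁ digits entry bound loc =
        subst₂ (λ q n → ValidEntry (stepG G k) k q i n) (sym j≡) (sym entry)
          (valid-assembled j₀<B j₀<B j₁<b y₁<b x<b (≼-refl j₀) j₁≤y₁ sums bound
            (trans loc (cong (_, i) j≡)))
        where
        sums : s b j₀ + (y₁ + x) ≡ (s b j₀ + j₁) + i
        sums = trans (cong (s b j₀ +_) digits) (sym (+-assoc (s b j₀) j₁ i))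

      valid : ∀ {i} → i < b → ValidEntry (stepG G k) k j i (stepF F k j i)
      valid {i} i<b with <-cmp i c
      ... | tri< i<c _ _ =
        valid-main (<-≤-trans i<c c≤b) j₁<b ≤-refl refl
          (trans (stepF-main j<cB) (mainEntry-< i<c)) (below-bk j₀<B j₁<b i<c)
          (trans (locate-1 i<c j₁<c) (cong (_, i) (sym j≡)))
      ... | tri> _ _ c<i =
        valid-main j₁<b i<b (<⇒≤ (<-trans j₁<c c<i)) (+-comm i j₁)
          (trans (stepF-main j<cB) (mainEntry-> c<i)) (below-bk j₀<B i<b j₁<c)
          (trans (locate-2 j₁<c c<i) (cong (_, i) (sym j≡)))
      ... | tri≈ _ refl _ with j <? b * r
      ...   | yes j<br =
        valid-main i<b j₁<b ≤-refl refl
          (trans (stepF-main j<cB) (mainEntry-low j<br))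
          (top-below-bk {j₁} {j₀} (subst (_< b * r) j≡ j<br))
          (trans (locate-5 j₁<c) (cong (_, c) (sym j≡)))
      ...   | no j≮br =
        valid-main j₁<b i<b (<⇒≤ j₁<c) (+-comm c j₁)
          (trans (stepF-main j<cB) (mainEntry-high j≮br)) (below-bk j₀<B i<b j₁<c)
          (trans (locate-4 j₁<c (λ low<br → j≮br (subst (_< b * r) (sym j≡) low<br))) (cong (_, c) (sym j≡)))

      firstRow : stepF F k j 0 ≡ j
      firstRow = begin
        stepF F k j 0              ≡⟨ stepF-main j<cB ⟩
        mainEntry c r j 0          ≡⟨ mainEntry-< (≤-<-trans z≤n j₁<c) ⟩
        j₀ + (j₁ + 0) * B          ≡⟨ cong (λ q → j₀ + q * B) (+-identityʳ j₁) ⟩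
        j₀ + j₁ * B                ≡⟨ sym j≡ ⟩
        j                          ∎
        where open ≡-Reasoning

    module TopColumn {j₀ i} (j₀<r : j₀ < r) (i<b : i < b) where
      open ValidEntry (validᵣ j₀<r i<b)

      z d y₀ : ℕ
      z  = F r j₀ i
      d  = z / B
      y₀ = z % B

      z≡ : z ≡ y₀ + d * B
      z≡ = m≡m%n+[m/n]*n z B

      j₀<B : j₀ < B
      j₀<B = <-trans j₀<r r<B

      y₀<B : y₀ < B
      y₀<B = m%n<n z B

      parts<br : y₀ + d * B < b * r
      parts<br = subst (_< b * r) z≡ bounded

      d<b : d < b
      d<b = m<n*o⇒m/o<n (<-trans bounded (*-monoʳ-< b r<B))

      c<b′ : c < b
      c<b′ = c<b bounded

      j₀≼y₀ : j₀ ≼[ b ] y₀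
      j₀≼y₀ = ≼-truncate m {w = d} j₀<B y₀<B (subst (λ q → j₀ ≼[ b ] q) z≡ above)

      s-parts : s b y₀ + d ≡ s b j₀ + i
      s-parts = trans (sym (column-s y₀<B d<b)) (trans (cong (s b) (sym z≡)) digitSum)

      liftPos-z : liftPos c (G r (y₀ + d * B)) ≡ (j₀ + c * B , i)
      liftPos-z = cong (liftPos c) (trans (cong (G r) (sym z≡)) located)

      -- Whichever order c and d are written in, the digit sum grows by c + i.
      sums : ∀ {x y₁} → y₁ + x ≡ c + d → s b y₀ + (y₁ + x) ≡ (s b j₀ + c) + i
      sums {x} {y₁} digits = begin
        s b y₀ + (y₁ + x)      ≡⟨ cong (s b y₀ +_) (trans digits (+-comm c d)) ⟩
        s b y₀ + (d + c)       ≡⟨ sym (+-assoc (s b y₀) d c) ⟩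
        (s b y₀ + d) + c       ≡⟨ cong (_+ c) s-parts ⟩
        (s b j₀ + i) + c       ≡⟨ swap (s b j₀) i c ⟩
        (s b j₀ + c) + i       ∎
        where
        open ≡-Reasoning
        swap : ∀ a i c → (a + i) + c ≡ (a + c) + i
        swap = solve-∀

      valid-lift : ValidEntry (stepG G k) k (j₀ + c * B) i (lift c z)
      valid-lift with d <? c
      ... | yes d<c = subst (ValidEntry (stepG G k) k (j₀ + c * B) i) (sym (lift-below d<c))
        (valid-assembled j₀<B y₀<B c<b′ c<b′ d<b j₀≼y₀ ≤-refl (sums {d} {c} refl)
          (below-bk y₀<B c<b′ d<c) (trans (locate-3 d<c parts<br) liftPos-z))
      ... | no d≮c = subst (ValidEntry (stepG G k) k (j₀ + c * B) i) (sym (lift-above d≮c))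
        (valid-assembled j₀<B y₀<B c<b′ d<b c<b′ j₀≼y₀ (≮⇒≥ d≮c) (sums {c} {d} (+-comm d c))
          (top-below-bk {d} {y₀} parts<br) (trans (locate-6 d≮c) liftPos-z))

      valid : ValidEntry (stepG G k) k (j₀ + c * B) i (stepF F k (j₀ + c * B) i)
      valid = subst (ValidEntry (stepG G k) k (j₀ + c * B) i) (sym (stepF-top j₀ i)) valid-lift

      firstRow : stepF F k (j₀ + c * B) 0 ≡ j₀ + c * B
      firstRow = trans (stepF-top j₀ 0) (trans (cong (lift c) (firstRowᵣ j₀<r)) (lift-small {c} j₀<B))

    -- Every n < b k occurs.  Split n = assemble x y₁ y₀, where x ≤ c; the
    -- cases mirror those of locate.
    module Onto {n} (n<bk : n < b * k) where
      x y₁ y₀ : ℕ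
      x  = n / B / b
      y₁ = n / B % b
      y₀ = n % B

      n≡ : n ≡ assemble x y₁ y₀
      n≡ = assemble-parts n

      y₀<B : y₀ < B
      y₀<B = m%n<n n B

      y₁<b : y₁ < b
      y₁<b = m%n<n (n / B) b

      Hit : Set
      Hit = ∃[ j ] ∃[ i ] (j < k × i < b × stepF F k j i ≡ n)

      hit-main : ∀ {w i} → w < c → i < b → mainEntry c r (y₀ + w * B) i ≡ n → Hit
      hit-main {w} {i} w<c i<b entry =
        y₀ + w * B , i , <-≤-trans j<cB cB≤k , i<b , trans (stepF-main j<cB) entry
        where
        j<cB : y₀ + w * B < c * B
        j<cB = v+w*X<Y*X y₀<B w<c

      hit-top : ∀ {z} → z < b * r → lift c z ≡ n → Hit
      hit-top z<br lifted with j₀ , i , j₀<r , i<b , entry ← ontoᵣ z<br =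
        j₀ + c * B , i , top<k j₀<r , i<b , trans (stepF-top j₀ i) (trans (cong (lift c) entry) lifted)

      parts : ∀ (f : ℕ → ℕ → ℕ) w → f ((y₀ + w * B) / B) ((y₀ + w * B) % B) ≡ f w y₀
      parts f w = cong₂ f ([v+w*n]/n≡w y₀ w y₀<B) ([v+w*n]%n≡v y₀ w y₀<B)

      hit-x<c,y₁≡c : x < c → y₁ ≡ c → Hit
      hit-x<c,y₁≡c x<c y₁≡c = by-size (y₀ + x * B <? b * r)
        where
        n≡xc : assemble x c y₀ ≡ n
        n≡xc = sym (trans n≡ (cong (λ q → assemble x q y₀) y₁≡c))
        by-size : Dec (y₀ + x * B < b * r) → Hit
        by-size (yes low<br) =
          hit-top low<br (trans (lift-below (subst (_< c) (sym ([v+w*n]/n≡w y₀ x y₀<B)) x<c))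
                           (trans (parts (λ p q → assemble p c q) x) n≡xc))
        by-size (no low≮br) =
          hit-main x<c (subst (_< b) y₁≡c y₁<b)
            (trans (mainEntry-high low≮br) (trans (parts (λ p q → assemble p c q) x) n≡xc))

      hit-x<c : x < c → Hit
      hit-x<c x<c with <-cmp y₁ c
      ... | tri< y₁<c _ _ = hit-main y₁<c (<-≤-trans x<c c≤b)
                              (trans (mainEntry-< x<c) (trans (parts (assemble x) y₁) (sym n≡)))
      ... | tri> _ _ c<y₁ = hit-main x<c y₁<b
                              (trans (mainEntry-> c<y₁) (trans (parts (λ p q → assemble p y₁ q) x) (sym n≡)))
      ... | tri≈ _ y₁≡c _ = hit-x<c,y₁≡c x<c y₁≡c

      hit-x≡c : x ≡ c → Hit
      hit-x≡c x≡c = by-digit (y₁ <? c)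
        where
        n≡cy₁ : assemble c y₁ y₀ ≡ n
        n≡cy₁ = sym (trans n≡ (cong (λ q → assemble q y₁ y₀) x≡c))
        parts<br : y₀ + y₁ * B < b * r
        parts<br = low<br {y₁} {y₀} (subst (_< b * k) (sym n≡cy₁) n<bk)
        by-digit : Dec (y₁ < c) → Hit
        by-digit (yes y₁<c) =
          hit-main y₁<c (c<b parts<br)
            (trans (mainEntry-low parts<br) (trans (parts (assemble c) y₁) n≡cy₁))
        by-digit (no y₁≮c) =
          hit-top parts<br
            (trans (lift-above (subst (λ q → ¬ (q < c)) (sym ([v+w*n]/n≡w y₀ y₁ y₀<B)) y₁≮c))
              (trans (parts (λ p q → assemble c p q) y₁) n≡cy₁))

      hit : Hit
      hit = [ hit-x<c , hit-x≡c ]′ (m≤n⇒m<n∨m≡n (top-digit≤c n<bk))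

    top-column : ∀ {j} → j < k → ¬ (j < c * B) → j ∸ c * B < r
    top-column {j} j<k j≮cB =
      +-cancelʳ-< (c * B) (j ∸ c * B) r (subst₂ _<_ (sym (m∸n+n≡m (≮⇒≥ j≮cB))) k≡r+cB j<k)

    solution : Solution (stepF F k) (stepG G k) k
    solution = record { valid = valid ; firstRow = firstRow ; onto = Onto.hit }
      where
      valid : ∀ {j i} → j < k → i < b → ValidEntry (stepG G k) k j i (stepF F k j i)
      valid {j} {i} j<k i<b with j <? c * B
      ... | yes j<cB = MainColumn.valid j<cB i<b
      ... | no j≮cB  = subst (λ q → ValidEntry (stepG G k) k q i (stepF F k q i))
                         (m∸n+n≡m (≮⇒≥ j≮cB)) (TopColumn.valid (top-column j<k j≮cB) i<b)

      firstRow : ∀ {j} → j < k → stepF F k j 0 ≡ j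
      firstRow {j} j<k with j <? c * B
      ... | yes j<cB = MainColumn.firstRow j<cB
      ... | no j≮cB  = subst (λ q → stepF F k q 0 ≡ q)
                         (m∸n+n≡m (≮⇒≥ j≮cB)) (TopColumn.firstRow (top-column j<k j≮cB) (>-nonZero⁻¹ b))

  -- The matrices and their locating maps, by recursion on the number m of
  -- base-b digits: F m k is meant for widths k ≤ b ^ (m + 1).
  F : ℕ → ℕ → ℕ → ℕ → ℕ
  F zero    = Step.stepF 0 (λ _ _ _ → 0)
  F (suc m) = Step.stepF (suc m) (F m)

  G : ℕ → ℕ → ℕ → ℕ × ℕ
  G zero    = Step.stepG 0 (λ _ _ → (0 , 0))
  G (suc m) = Step.stepG (suc m) (G m)

  empty : ∀ (f : ℕ → ℕ → ℕ → ℕ) (g : ℕ → ℕ → ℕ × ℕ) r → r < 1 → Solution (f r) (g r) r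
  empty f g zero    _ = record
    { valid    = λ ()
    ; firstRow = λ ()
    ; onto     = λ {n} n<b*0 → ⊥-elim (n≮0 (subst (n <_) (*-zeroʳ b) n<b*0))
    }
  empty f g (suc r) (s≤s ())

  solution : ∀ m k → k ≤ b * b ^ m → Solution (F m k) (G m k) k
  solution zero    = StepCorrect.solution 0 (λ _ _ _ → 0) (λ _ _ → (0 , 0)) (empty _ _)
  solution (suc m) = StepCorrect.solution (suc m) (F m) (G m) (λ r r< → solution m r (<⇒≤ r<))

theorem5 : (b : ℕ) → .{{_ : NonZero b}} → 2 ≤ b → (k : ℕ) → 1 ≤ k →
    Σ (Fin b → Fin k → ℕ) λ A →
      ((∀ i j → A i j < b * k)
      × (∀ i j i′ j′ → A i j ≡ A i′ j′ → (i ≡ i′ × j ≡ j′))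
      × (∀ n → n < b * k → ∃[ i ] ∃[ j ] (A i j ≡ n)))
      × (∀ (j : Fin k) (i₀ : Fin b) → toℕ i₀ ≡ 0 → A i₀ j ≡ toℕ j)
      × (∀ (i₀ i : Fin b) (j : Fin k) → toℕ i₀ ≡ 0 → A i₀ j ≼[ b ] A i j)
      × (∀ (i₀ i : Fin b) (j : Fin k) → toℕ i₀ ≡ 0 →
           (∃[ rs ] (length rs ≡ toℕ i × A i j ≡ A i₀ j + sumPowers b rs))
           × s b (A i j) ≡ s b (A i₀ j) + toℕ i)
theorem5 b 2≤b k _ = A , (bounded ∘₂ entry , injective , onto′) , row₀ , above′ , powers
  where
  open DigitSum b 2≤b using (n<b^n; exactly-powers)
  open Construction b 2≤b
  open ValidEntry
  open Solution (solution k k (≤-trans (<⇒≤ (n<b^n k)) (m≤n*m (b ^ k) b)))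
  A : Fin b → Fin k → ℕ
  A i j = F k k (toℕ j) (toℕ i)
  entry : ∀ i j → ValidEntry (G k k) k (toℕ j) (toℕ i) (A i j)
  entry i j = valid (toℕ<n j) (toℕ<n i)
  row₀ : ∀ j i₀ → toℕ i₀ ≡ 0 → A i₀ j ≡ toℕ j
  row₀ j i₀ i₀≡0 = trans (cong (F k k (toℕ j)) i₀≡0) (firstRow (toℕ<n j))
  above′ : ∀ i₀ i j → toℕ i₀ ≡ 0 → A i₀ j ≼[ b ] A i j
  above′ i₀ i j i₀≡0 rewrite row₀ j i₀ i₀≡0 = above (entry i j)
  powers : ∀ i₀ i j → toℕ i₀ ≡ 0 →
    (∃[ rs ] (length rs ≡ toℕ i × A i j ≡ A i₀ j + sumPowers b rs)) × s b (A i j) ≡ s b (A i₀ j) + toℕ i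
  powers i₀ i j i₀≡0 rewrite row₀ j i₀ i₀≡0 =
    exactly-powers (above (entry i j)) (digitSum (entry i j)) , digitSum (entry i j)
  injective : ∀ i j i′ j′ → A i j ≡ A i′ j′ → (i ≡ i′ × j ≡ j′)
  injective i j i′ j′ A≡ = toℕ-injective (cong proj₂ same) , toℕ-injective (cong proj₁ same)
    where
    same : (toℕ j , toℕ i) ≡ (toℕ j′ , toℕ i′)
    same = trans (sym (located (entry i j))) (trans (cong (G k k) A≡) (located (entry i′ j′)))
  onto′ : ∀ n → n < b * k → ∃[ i ] ∃[ j ] (A i j ≡ n)
  onto′ n n<bk with j , i , j<k , i<b , F≡n ← onto n<bk =
    fromℕ< i<b , fromℕ< j<k , trans (cong₂ (F k k) (toℕ-fromℕ< j<k) (toℕ-fromℕ< i<b)) F≡n
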